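{- Let $G$ be a graph and let $G\overline{G}$ be its complementary prism. If $P: u_1,u_2,u_3,u_4$ is an induced path in $G$, then $\{u_1,u_2,u_3,u_4\} \cup \{\overline{u_1},\overline{u_2},\overline{u_3},\overline{u_4}\} \subseteq J_{G\overline{G}}[u_1,u_4]$.
   Context: All graphs are finite, simple and undirected. The complementary prism $G\overline{G}$ of a graph $G$ is the graph obtained from the disjoint union of $G$ and its complement $\overline{G}$ by adding the edges of the perfect matching joining each vertex $u$ of $G$ to its copy in $\overline{G}$; this copy is denoted $\overline{u}$ (the partner of $u$). A path is monophonic (induced) if it has no chord, i.e. no edge joining two non-consecutive vertices of the path. For vertices $u,v$ of a graph $H$, the monophonic interval $J_H[u,v]$ is the set of all vertices lying on some monophonic $u,v$-path in $H$. -}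

module Defs where

open import Level using (Level; _⊔_; suc)
open import Data.Nat using (ℕ; _+_; _<_)
open import Data.Fin using (Fin; toℕ)
open import Data.Sum using (_⊎_; inj₁; inj₂)
open import Data.Product using (Σ; _×_; ∃)
open import Data.Empty using (⊥)
open import Data.List using (List; []; _∷_; length; lookup)
open import Data.List.Relation.Unary.Unique.Propositional using (Unique)
open import Data.List.Membership.Propositional using (_∈_)
open import Relation.Nullary using (¬_)
open import Relation.Binary.PropositionalEquality using (_≡_)

record Graph (n : ℕ) : Set₁ where
  field
    Adj    : Fin n → Fin n → Set
    sym    : ∀ {x y} → Adj x y → Adj y x
    irrefl : ∀ {x} → ¬ Adj x x
open Graph public

complement : ∀ {n} → Graph n → Graph n
complement G = record
  { Adj    = λ x y → ¬ (x ≡ y) × ¬ Adj G x y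
  ; sym    = λ { (p , q) → (λ e → p (Relation.Binary.PropositionalEquality.sym e)) , (λ a → q (Graph.sym G a)) }
  ; irrefl = λ { (p , _) → p Relation.Binary.PropositionalEquality.refl }
  }
  where open Data.Product using (_,_)

record GraphOn (V : Set) : Set₁ where
  field
    E     : V → V → Set
    E-sym : ∀ {x y} → E x y → E y x
    E-irr : ∀ {x} → ¬ E x x
open GraphOn public

-- Vertices of the complementary prism: inj₁ u is u in G, inj₂ u is its copy ū in Ḡ.
PrismV : ℕ → Set
PrismV n = Fin n ⊎ Fin n

bar : ∀ {n} → Fin n → PrismV n
bar = inj₂

PrismAdj : ∀ {n} → Graph n → PrismV n → PrismV n → Set
PrismAdj G (inj₁ x) (inj₁ y) = Adj G x y
PrismAdj G (inj₂ x) (inj₂ y) = Adj (complement G) x y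
PrismAdj G (inj₁ x) (inj₂ y) = x ≡ y
PrismAdj G (inj₂ x) (inj₁ y) = x ≡ y

complementaryPrism : ∀ {n} → Graph n → GraphOn (PrismV n)
complementaryPrism G = record
  { E     = PrismAdj G
  ; E-sym = λ {x} {y} → s x y
  ; E-irr = λ {x} → i x
  }
  where
    open Relation.Binary.PropositionalEquality using (refl) renaming (sym to ≡sym)
    s : ∀ x y → PrismAdj G x y → PrismAdj G y x
    s (inj₁ x) (inj₁ y) a = Graph.sym G a
    s (inj₂ x) (inj₂ y) a = Graph.sym (complement G) a
    s (inj₁ x) (inj₂ y) a = ≡sym a
    s (inj₂ x) (inj₁ y) a = ≡sym a
    i : ∀ x → ¬ PrismAdj G x x
    i (inj₁ x) = Graph.irrefl G
    i (inj₂ x) = Graph.irrefl (complement G)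

record MonophonicPath {V : Set} (H : GraphOn V) (u v : V) : Set where
  field
    verts      : List V
    first      : ∀ (i : Fin (length verts)) → toℕ i ≡ 0 → lookup verts i ≡ u
    last       : ∀ (i : Fin (length verts)) → 1 + toℕ i ≡ length verts → lookup verts i ≡ v
    nonempty   : 0 < length verts
    distinct   : Unique verts
    consecutive : ∀ (i j : Fin (length verts)) → 1 + toℕ i ≡ toℕ j →
                  E H (lookup verts i) (lookup verts j)
    chordless  : ∀ (i j : Fin (length verts)) → 1 + toℕ i < toℕ j →
                  ¬ E H (lookup verts i) (lookup verts j)
open MonophonicPath public

J : ∀ {V : Set} → GraphOn V → V → V → V → Set
J H u v w = Σ (MonophonicPath H u v) (λ P → w ∈ verts P)

InducedP4 : ∀ {n} → Graph n → Fin n → Fin n → Fin n → Fin n → Set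
InducedP4 G u₁ u₂ u₃ u₄ =
  Adj G u₁ u₂ × Adj G u₂ u₃ × Adj G u₃ u₄ ×
  ¬ Adj G u₁ u₃ × ¬ Adj G u₁ u₄ × ¬ Adj G u₂ u₄ ×
  ¬ u₁ ≡ u₂ × ¬ u₁ ≡ u₃ × ¬ u₁ ≡ u₄ × ¬ u₂ ≡ u₃ × ¬ u₂ ≡ u₄ × ¬ u₃ ≡ u₄

{-# OPTIONS --safe #-}
module Submission where

-- Every uᵢ and ūᵢ lies on one of four chordless u₁,u₄-paths of G Ḡ:
-- the path u₁ u₂ u₃ u₄ itself, and the detours u₁ ū₁ ū₄ u₄, u₁ u₂ ū₂ ū₄ u₄ and
-- u₁ ū₁ ū₃ u₃ u₄.  Their middle edges ūᵢūⱼ exist because uᵢuⱼ is a non-edge of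
-- the P₄, and they have no chords because a vertex of G is adjacent in G Ḡ to
-- only one vertex of Ḡ, its partner.

open import Defs
open import Data.Nat using (ℕ; _+_; _<_; s≤s; z≤n)
open import Data.Nat.Properties using (suc-injective)
open import Data.Fin using (Fin; zero; suc; toℕ)
open import Data.Sum using (inj₁; inj₂)
open import Data.Sum.Properties using (inj₁-injective; inj₂-injective)
open import Data.Product using (_×_; _,_)
open import Data.Unit using (⊤)
open import Data.List using (List; []; _∷_; _∷ʳ_; length; lookup)
open import Data.List.Membership.Propositional using (_∈_)
open import Data.List.Membership.Propositional.Properties using (∈-lookup)
open import Data.List.Relation.Unary.All as All using (All; []; _∷_)
open import Data.List.Relation.Unary.AllPairs using ([]; _∷_)
open import Data.List.Relation.Unary.Any using (here; there)
open import Data.List.Relation.Unary.Linked using (Linked; [-]; _∷_)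
open import Data.List.Relation.Unary.Unique.Propositional using (Unique)
open import Function using (_∘_; _∋_)
open import Relation.Binary.PropositionalEquality using (_≡_; _≢_; refl)
open import Relation.Nullary using (¬_)

module _ {A : Set} where

  lookup-∷ʳ-last : ∀ (xs : List A) x (i : Fin (length (xs ∷ʳ x))) →
                   1 + toℕ i ≡ length (xs ∷ʳ x) → lookup (xs ∷ʳ x) i ≡ x
  lookup-∷ʳ-last []           x zero    _  = refl
  lookup-∷ʳ-last (_ ∷ [])     x zero    ()
  lookup-∷ʳ-last (_ ∷ _ ∷ _)  x zero    ()
  lookup-∷ʳ-last (_ ∷ ys)     x (suc i) eq = lookup-∷ʳ-last ys x i (suc-injective eq)

  lookup-Linked : ∀ {R : A → A → Set} {xs} → Linked R xs →
                  ∀ (i j : Fin (length xs)) → 1 + toℕ i ≡ toℕ j → R (lookup xs i) (lookup xs j)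
  lookup-Linked (r ∷ _)  zero    (suc zero)    _  = r
  lookup-Linked (_ ∷ rs) (suc i) (suc j)       eq = lookup-Linked rs i j (suc-injective eq)
  lookup-Linked [-]      zero    zero          ()
  lookup-Linked (_ ∷ _)  zero    zero          ()
  lookup-Linked (_ ∷ _)  zero    (suc (suc _)) ()

module _ {V : Set} (H : GraphOn V) where

  Chordless : List V → Set
  Chordless (x ∷ y ∷ zs) = All (λ z → ¬ E H x z) zs × Chordless (y ∷ zs)
  Chordless _            = ⊤

  lookup-Chordless : ∀ {xs} → Chordless xs →
                     ∀ (i j : Fin (length xs)) → 1 + toℕ i < toℕ j → ¬ E H (lookup xs i) (lookup xs j)
  lookup-Chordless {_ ∷ _ ∷ _} (noChord , _) zero    (suc (suc k)) _         = All.lookup noChord (∈-lookup k)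
  lookup-Chordless {_ ∷ _ ∷ _} (_ , rest)    (suc i) (suc j)       (s≤s lt) = lookup-Chordless rest i j lt
  lookup-Chordless {_ ∷ _ ∷ _} _             zero    (suc zero)    (s≤s ())
  lookup-Chordless {_ ∷ _}     _             zero    zero          ()

  monophonicPath : ∀ u ws v → let vs = u ∷ ws ∷ʳ v in
                   Unique vs → Linked (E H) vs → Chordless vs → MonophonicPath H u v
  monophonicPath u ws v unique linked chordless = record
    { verts       = u ∷ ws ∷ʳ v
    ; first       = λ { zero _ → refl ; (suc _) () }
    ; last        = lookup-∷ʳ-last (u ∷ ws) v
    ; nonempty    = s≤s z≤n
    ; distinct    = unique
    ; consecutive = lookup-Linked linked
    ; chordless   = lookup-Chordless chordless
    }

module _ {n : ℕ} (G : Graph n) {u₁ u₂ u₃ u₄ : Fin n} where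

  private
    GḠ : GraphOn (PrismV n)
    GḠ = complementaryPrism G

    ≢-inj₁ : ∀ {a b : Fin n} → a ≢ b → inj₁ a ≢ (PrismV n ∋ inj₁ b)
    ≢-inj₁ a≢b = a≢b ∘ inj₁-injective

    ≢-inj₂ : ∀ {a b : Fin n} → a ≢ b → inj₂ a ≢ (PrismV n ∋ inj₂ b)
    ≢-inj₂ a≢b = a≢b ∘ inj₂-injective

  path-u₁u₂u₃u₄ : InducedP4 G u₁ u₂ u₃ u₄ → MonophonicPath GḠ (inj₁ u₁) (inj₁ u₄)
  path-u₁u₂u₃u₄ (a₁₂ , a₂₃ , a₃₄ , n₁₃ , n₁₄ , n₂₄ , d₁₂ , d₁₃ , d₁₄ , d₂₃ , d₂₄ , d₃₄) =
    monophonicPath GḠ (inj₁ u₁) (inj₁ u₂ ∷ inj₁ u₃ ∷ []) (inj₁ u₄)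
      ((≢-inj₁ d₁₂ ∷ ≢-inj₁ d₁₃ ∷ ≢-inj₁ d₁₄ ∷ []) ∷ (≢-inj₁ d₂₃ ∷ ≢-inj₁ d₂₄ ∷ []) ∷ (≢-inj₁ d₃₄ ∷ []) ∷ [] ∷ [])
      (a₁₂ ∷ a₂₃ ∷ a₃₄ ∷ [-])
      ((n₁₃ ∷ n₁₄ ∷ []) , (n₂₄ ∷ []) , [] , _)

  path-u₁ū₁ū₄u₄ : InducedP4 G u₁ u₂ u₃ u₄ → MonophonicPath GḠ (inj₁ u₁) (inj₁ u₄)
  path-u₁ū₁ū₄u₄ (_ , _ , _ , _ , n₁₄ , _ , _ , _ , d₁₄ , _ , _ , _) =
    monophonicPath GḠ (inj₁ u₁) (inj₂ u₁ ∷ inj₂ u₄ ∷ []) (inj₁ u₄)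
      (((λ ()) ∷ (λ ()) ∷ ≢-inj₁ d₁₄ ∷ []) ∷ (≢-inj₂ d₁₄ ∷ (λ ()) ∷ []) ∷ ((λ ()) ∷ []) ∷ [] ∷ [])
      (refl ∷ (d₁₄ , n₁₄) ∷ refl ∷ [-])
      ((d₁₄ ∷ n₁₄ ∷ []) , (d₁₄ ∷ []) , [] , _)

  path-u₁u₂ū₂ū₄u₄ : InducedP4 G u₁ u₂ u₃ u₄ → MonophonicPath GḠ (inj₁ u₁) (inj₁ u₄)
  path-u₁u₂ū₂ū₄u₄ (a₁₂ , _ , _ , _ , n₁₄ , n₂₄ , d₁₂ , _ , d₁₄ , _ , d₂₄ , _) =
    monophonicPath GḠ (inj₁ u₁) (inj₁ u₂ ∷ inj₂ u₂ ∷ inj₂ u₄ ∷ []) (inj₁ u₄)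
      ((≢-inj₁ d₁₂ ∷ (λ ()) ∷ (λ ()) ∷ ≢-inj₁ d₁₄ ∷ []) ∷ ((λ ()) ∷ (λ ()) ∷ ≢-inj₁ d₂₄ ∷ []) ∷
       (≢-inj₂ d₂₄ ∷ (λ ()) ∷ []) ∷ ((λ ()) ∷ []) ∷ [] ∷ [])
      (a₁₂ ∷ refl ∷ (d₂₄ , n₂₄) ∷ refl ∷ [-])
      ((d₁₂ ∷ d₁₄ ∷ n₁₄ ∷ []) , (d₂₄ ∷ n₂₄ ∷ []) , (d₂₄ ∷ []) , [] , _)

  path-u₁ū₁ū₃u₃u₄ : InducedP4 G u₁ u₂ u₃ u₄ → MonophonicPath GḠ (inj₁ u₁) (inj₁ u₄)
  path-u₁ū₁ū₃u₃u₄ (_ , _ , a₃₄ , n₁₃ , n₁₄ , _ , _ , d₁₃ , d₁₄ , _ , _ , d₃₄) =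
    monophonicPath GḠ (inj₁ u₁) (inj₂ u₁ ∷ inj₂ u₃ ∷ inj₁ u₃ ∷ []) (inj₁ u₄)
      (((λ ()) ∷ (λ ()) ∷ ≢-inj₁ d₁₃ ∷ ≢-inj₁ d₁₄ ∷ []) ∷ (≢-inj₂ d₁₃ ∷ (λ ()) ∷ (λ ()) ∷ []) ∷
       ((λ ()) ∷ (λ ()) ∷ []) ∷ (≢-inj₁ d₃₄ ∷ []) ∷ [] ∷ [])
      (refl ∷ (d₁₃ , n₁₃) ∷ refl ∷ a₃₄ ∷ [-])
      ((d₁₃ ∷ n₁₃ ∷ n₁₄ ∷ []) , (d₁₃ ∷ d₁₄ ∷ []) , (d₃₄ ∷ []) , [] , _)

proposition2p4 : ∀ {n : ℕ} (G : Graph n) (u₁ u₂ u₃ u₄ : Fin n) →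
    InducedP4 G u₁ u₂ u₃ u₄ →
    ∀ (w : PrismV n) →
    w ∈ (inj₁ u₁ ∷ inj₁ u₂ ∷ inj₁ u₃ ∷ inj₁ u₄ ∷ bar u₁ ∷ bar u₂ ∷ bar u₃ ∷ bar u₄ ∷ []) →
    J (complementaryPrism G) (inj₁ u₁) (inj₁ u₄) w
proposition2p4 G _ _ _ _ p _ (here refl)                                                         = path-u₁u₂u₃u₄ G p , here refl
proposition2p4 G _ _ _ _ p _ (there (here refl))                                                 = path-u₁u₂u₃u₄ G p , there (here refl)
proposition2p4 G _ _ _ _ p _ (there (there (here refl)))                                         = path-u₁u₂u₃u₄ G p , there (there (here refl))
proposition2p4 G _ _ _ _ p _ (there (there (there (here refl))))                                 = path-u₁u₂u₃u₄ G p , there (there (there (here refl)))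
proposition2p4 G _ _ _ _ p _ (there (there (there (there (here refl)))))                         = path-u₁ū₁ū₄u₄ G p , there (here refl)
proposition2p4 G _ _ _ _ p _ (there (there (there (there (there (here refl))))))                 = path-u₁u₂ū₂ū₄u₄ G p , there (there (here refl))
proposition2p4 G _ _ _ _ p _ (there (there (there (there (there (there (here refl)))))))         = path-u₁ū₁ū₃u₃u₄ G p , there (there (here refl))
proposition2p4 G _ _ _ _ p _ (there (there (there (there (there (there (there (here refl)))))))) = path-u₁ū₁ū₄u₄ G p , there (there (here refl))
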